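{- Let $\mathbf{G}=(G,*)$ be a commutative groupoid with a neutral element $e$ (i.e., $e*x=x*e=x$ for all $x\in G$). Then either (i) $\mathbf{G}$ is associative, in which case $s_n(\mathbf{G})=s^{\mathrm{ac}}_n(\mathbf{G})=1$ for all $n\in\mathbb{N}_+$, or (ii) $s_n(\mathbf{G})=C_{n-1}$ and $s^{\mathrm{ac}}_n(\mathbf{G})=D_{n-1}$ for all $n\ge1$.
   Context: For $X_n=\{x_1,\dots,x_n\}$, groupoid terms over $X_n$ are built recursively from variables by $(s,t)\mapsto (st)$. A full linear term over $X_n$ is a term in which each of $x_1,\dots,x_n$ occurs exactly once; a bracketing is a full linear term whose variables appear in order $x_1,\dots,x_n$ from left to right. Each term induces an $n$-ary term operation on $\mathbf{G}$. $s^{\mathrm{ac}}_n(\mathbf{G})$ (resp. $s_n(\mathbf{G})$) is the number of distinct term operations induced by full linear terms (resp. bracketings) over $X_n$. $C_m=\frac{1}{m+1}\binom{2m}{m}$ and $D_m=(2m)!/(2^m m!)$. -}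

module Defs where

open import Data.Nat using (ℕ; zero; suc; _*_; _^_; _/_; NonZero; _!)
open import Data.Nat.Properties using (_!≢0; m^n≢0; m*n≢0)
open import Data.Nat.Combinatorics using (_C_)
open import Data.Fin using (Fin)
open import Data.List using (List; []; _∷_; _++_; length; allFin)
open import Data.List.Relation.Unary.All using (All)
open import Data.List.Relation.Unary.Any using (Any)
open import Data.List.Relation.Unary.AllPairs using (AllPairs)
open import Data.List.Relation.Binary.Permutation.Propositional using (_↭_)
open import Data.Product using (Σ; _×_)
open import Relation.Binary.PropositionalEquality using (_≡_)
open import Relation.Nullary using (¬_)

data Term (n : ℕ) : Set where
  var : Fin n → Term n
  _·_ : Term n → Term n → Term n

leaves : ∀ {n} → Term n → List (Fin n)
leaves (var i) = i ∷ []
leaves (s · t) = leaves s ++ leaves t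

FullLinear : ∀ {n} → Term n → Set
FullLinear {n} t = leaves t ↭ allFin n

Bracketing : ∀ {n} → Term n → Set
Bracketing {n} t = leaves t ≡ allFin n

⟦_⟧ : ∀ {G : Set} {n} → Term n → (G → G → G) → (Fin n → G) → G
⟦ var i ⟧ _∙_ ρ = ρ i
⟦ s · t ⟧ _∙_ ρ = _∙_ (⟦ s ⟧ _∙_ ρ) (⟦ t ⟧ _∙_ ρ)

SameOp : ∀ {G : Set} {n} → (G → G → G) → Term n → Term n → Set
SameOp _∙_ s t = ∀ ρ → ⟦ s ⟧ _∙_ ρ ≡ ⟦ t ⟧ _∙_ ρ

NumOps : ∀ {G : Set} {n} → (G → G → G) → (Term n → Set) → ℕ → Set
NumOps {G} {n} _∙_ P k =
  Σ (List (Term n)) λ ts →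
    (length ts ≡ k)
    × All P ts
    × AllPairs (λ s t → ¬ SameOp _∙_ s t) ts
    × (∀ t → P t → Any (SameOp _∙_ t) ts)

s-is : ∀ {G : Set} → (G → G → G) → ℕ → ℕ → Set
s-is _∙_ n k = NumOps {n = n} _∙_ Bracketing k

sac-is : ∀ {G : Set} → (G → G → G) → ℕ → ℕ → Set
sac-is _∙_ n k = NumOps {n = n} _∙_ FullLinear k

Catalan : ℕ → ℕ
Catalan m = ((2 * m) C m) / suc m

D : ℕ → ℕ
D m = _/_ ((2 * m) !) (2 ^ m * m !) {{m*n≢0 (2 ^ m) (m !) {{m^n≢0 2 m}} {{m !≢0}}}}

-- Bracketings of x₁ … xₙ correspond to binary tree shapes with n leaves, of
-- which there are C_{n−1} (counted via ballot numbers); up to commutativity,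
-- every full linear term arises from one on x₂ … xₙ by attaching x₁ beside one
-- of its 2n − 3 subterms, giving (2n − 3)!! = D_{n−1} representatives.  If G is
-- associative, commutativity makes every full linear term equal to the product
-- of its variables.  Otherwise distinct representatives induce distinct
-- operations: sending all but at most three variables to the neutral element
-- turns the two terms into two different bracketings of three values p, q, r,
-- and their equality for all p, q, r (with commutativity) is associativity.

module Submission where

open import Defs
open import Algebra.Core using (Op₂)
open import Algebra.Definitions
open import Algebra.Structures using (IsCommutativeMonoid)
open import Data.Empty using (⊥-elim)
open import Data.Fin as Fin using (Fin; zero; suc)
open import Data.List
  using (List; []; _∷_; _++_; [_]; length; map; concatMap; take; drop; foldr; allFin; tabulate)
open import Data.List.Properties
  using (++-assoc; ∷-injective; ∷-injectiveˡ; length-map; length-++; length-take; length-drop;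
         length-tabulate; take++drop≡id; foldr-++; map-++)
open import Data.List.Membership.Propositional using (_∈_; _∉_)
open import Data.List.Relation.Unary.All as All using (All; []; _∷_)
import Data.List.Relation.Unary.All.Properties as All
open import Data.List.Relation.Unary.Any as Any using (Any; here; there)
import Data.List.Relation.Unary.Any.Properties as Any
open import Data.List.Relation.Unary.AllPairs as AllPairs using (AllPairs; []; _∷_)
import Data.List.Relation.Unary.AllPairs.Properties as AllPairs
open import Data.List.Relation.Unary.Unique.Propositional using (Unique)
import Data.List.Relation.Unary.Unique.Propositional.Properties as Unique
open import Data.List.Relation.Binary.Permutation.Propositional
  using (_↭_; ↭-refl; ↭-sym; ↭-trans; ↭-prep; ↭-reflexive; ↭⇒↭ₛ)
open import Data.List.Relation.Binary.Permutation.Propositional.Properties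
  using (++-comm; shift; shifts; ++⁺ˡ; ++⁺ʳ; drop-∷; ∈-resp-↭; ↭-length; ↭-singleton-inv)
  renaming (map⁺ to ↭-map⁺)
import Data.List.Relation.Binary.Permutation.Setoid.Properties as ↭ₛ
open import Data.Nat using (ℕ; zero; suc; _+_; _*_; _∸_; _≤_; _<_; _/_; z≤n; s≤s; _^_; _!; NonZero)
open import Data.Nat.Combinatorics using (_C_; nCk≡nC[n∸k]; nCk+nC[k+1]≡[n+1]C[k+1]; k![n∸k]!∣n!)
open import Data.Nat.Combinatorics.Specification using (nCk≡n!/k![n-k]!)
open import Data.Nat.DivMod using (m/n*n≡m; /-congˡ; m*n/n≡m)
open import Data.Nat.Properties hiding (_≟_)
open import Data.Nat.Tactic.RingSolver using (solve-∀)
open import Data.Product using (Σ-syntax; _×_; _,_; proj₁; proj₂)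
open import Data.Sum using (_⊎_; inj₁; inj₂)
open import Data.Vec using (Vec; []; _∷_; head)
import Data.Vec.Properties as Vec
open import Data.Vec.Functional using (updateAt)
open import Data.Vec.Functional.Properties using (updateAt-updates; updateAt-minimal)
open import Function using (const; _∘_)
open import Relation.Binary.Definitions using (tri<; tri≈; tri>)
open import Relation.Binary.PropositionalEquality hiding ([_])
open import Relation.Binary.PropositionalEquality.Algebra using (isMagma)
open import Relation.Nullary using (¬_; Dec; yes; no)
import Relation.Nullary.Decidable as Dec
open import Relation.Nullary.Decidable using (_×-dec_)

module _ {A : Set} where

  Unique-++⁻ˡ : ∀ (xs : List A) {ys} → Unique (xs ++ ys) → Unique xs
  Unique-++⁻ˡ []       u        = []
  Unique-++⁻ˡ (x ∷ xs) (x∉ ∷ u) = proj₁ (All.++⁻ xs x∉) ∷ Unique-++⁻ˡ xs u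

  Unique-++⁻ʳ : ∀ (xs : List A) {ys} → Unique (xs ++ ys) → Unique ys
  Unique-++⁻ʳ []       u       = u
  Unique-++⁻ʳ (x ∷ xs) (_ ∷ u) = Unique-++⁻ʳ xs u

  Unique-++⇒≢ : ∀ (xs : List A) {ys i j} → Unique (xs ++ ys) → i ∈ xs → j ∈ ys → i ≢ j
  Unique-++⇒≢ (x ∷ xs) (x∉ ∷ u) (here refl) j∈ = All.lookup x∉ (Any.++⁺ʳ xs j∈)
  Unique-++⇒≢ (x ∷ xs) (_ ∷ u)  (there i∈)  j∈ = Unique-++⇒≢ xs u i∈ j∈

  Unique-resp-↭ : ∀ {xs ys : List A} → xs ↭ ys → Unique xs → Unique ys
  Unique-resp-↭ p = ↭ₛ.Unique-resp-↭ (setoid A) (↭⇒↭ₛ p)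

  ∉-++⁺ : ∀ {x : A} {xs ys} → x ∉ xs → x ∉ ys → x ∉ xs ++ ys
  ∉-++⁺ {xs = xs} x∉xs x∉ys x∈ with Any.++⁻ xs x∈
  ... | inj₁ x∈xs = x∉xs x∈xs
  ... | inj₂ x∈ys = x∉ys x∈ys

  AllPairs-mapWith : ∀ {P : A → Set} {R S : A → A → Set} →
    (∀ {a b} → P a → P b → R a b → S a b) →
    ∀ {xs} → All P xs → AllPairs R xs → AllPairs S xs
  AllPairs-mapWith f []         []         = []
  AllPairs-mapWith f (pa ∷ pas) (ra∷ ∷ rs) =
    All.zipWith (λ (pb , rab) → f pa pb rab) (pas , ra∷) ∷ AllPairs-mapWith f pas rs

  length-concatMap : ∀ {B : Set} (f : A → List B) {c} (xs : List A) →
    All (λ x → length (f x) ≡ c) xs → length (concatMap f xs) ≡ length xs * c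
  length-concatMap f []       []         = refl
  length-concatMap f (x ∷ xs) (eq ∷ eqs) =
    trans (length-++ (f x)) (cong₂ _+_ eq (length-concatMap f xs eqs))

  take-length-++ : ∀ (xs ys : List A) → take (length xs) (xs ++ ys) ≡ xs
  take-length-++ []       ys = refl
  take-length-++ (x ∷ xs) ys = cong (x ∷_) (take-length-++ xs ys)

  drop-length-++ : ∀ (xs ys : List A) → drop (length xs) (xs ++ ys) ≡ ys
  drop-length-++ []       ys = refl
  drop-length-++ (x ∷ xs) ys = drop-length-++ xs ys

  ++-injective-length : ∀ (xs ys us vs : List A) → xs ++ ys ≡ us ++ vs → length xs ≡ length us →
    xs ≡ us × ys ≡ vs
  ++-injective-length xs ys us vs eq l =
    trans (sym (take-length-++ xs ys)) (trans (cong₂ take l eq) (take-length-++ us vs)) ,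
    trans (sym (drop-length-++ xs ys)) (trans (cong₂ drop l eq) (drop-length-++ us vs))

  ++-split-< : ∀ (xs ys us vs : List A) → xs ++ ys ≡ us ++ vs → length xs < length us →
    Σ[ β ∈ A ] Σ[ M ∈ List A ] us ≡ xs ++ β ∷ M × ys ≡ β ∷ M ++ vs
  ++-split-< []       ys (u ∷ us) vs eq l       = u , us , refl , eq
  ++-split-< (x ∷ xs) ys (u ∷ us) vs eq (s≤s l) with refl , eq′ ← ∷-injective eq =
    let β , M , us≡ , ys≡ = ++-split-< xs ys us vs eq′ l in β , M , cong (x ∷_) us≡ , ys≡

-- Binary tree shapes, Catalan numbers and odd double factorials

data Shape : Set where
  leaf : Shape
  node : Shape → Shape → Shape

size : Shape → ℕ
size leaf       = 1
size (node a b) = size a + size b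

1≤size : ∀ s → 1 ≤ size s
1≤size leaf       = s≤s z≤n
1≤size (node a b) = ≤-trans (1≤size a) (m≤m+n _ _)

totalSize : ∀ {k} → Vec Shape k → ℕ
totalSize []      = 0
totalSize (s ∷ v) = size s + totalSize v

k≤totalSize : ∀ {k} (v : Vec Shape k) → k ≤ totalSize v
k≤totalSize []      = z≤n
k≤totalSize (s ∷ v) = +-mono-≤ (1≤size s) (k≤totalSize v)

joinFirst : ∀ {k} → Vec Shape (2 + k) → Vec Shape (1 + k)
joinFirst (a ∷ b ∷ v) = node a b ∷ v

joinFirst-injective : ∀ {k} (u w : Vec Shape (2 + k)) → joinFirst u ≡ joinFirst w → u ≡ w
joinFirst-injective (a ∷ b ∷ v) (.a ∷ .b ∷ .v) refl = refl

forests : ℕ → (k : ℕ) → List (Vec Shape k)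
forests zero    zero    = [ [] ]
forests (suc q) zero    = []
forests zero    (suc k) = map (leaf ∷_) (forests zero k)
forests (suc q) (suc k) = map (leaf ∷_) (forests (suc q) k) ++ map joinFirst (forests q (2 + k))

forests-totalSize : ∀ q k → All (λ v → totalSize v ≡ q + k) (forests q k)
forests-totalSize zero    zero    = refl ∷ []
forests-totalSize (suc q) zero    = []
forests-totalSize zero    (suc k) = All.map⁺ (All.map (cong suc) (forests-totalSize zero k))
forests-totalSize (suc q) (suc k) = All.++⁺
  (All.map⁺ (All.map (λ eq → trans (cong suc eq) (sym (+-suc (suc q) k))) (forests-totalSize (suc q) k)))
  (All.map⁺ (All.map (λ {v} → joined v) (forests-totalSize q (2 + k))))
  where
  joined : ∀ v → totalSize v ≡ q + (2 + k) → totalSize (joinFirst v) ≡ suc q + suc k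
  joined (a ∷ b ∷ v) eq = trans (+-assoc (size a) (size b) (totalSize v)) (trans eq (+-suc q (suc k)))

forests-complete : ∀ q k (v : Vec Shape k) → totalSize v ≡ q + k → v ∈ forests q k
forests-complete zero    zero    []               eq = here refl
forests-complete zero    (suc k) (leaf ∷ v)       eq =
  Any.map⁺ (Any.map (cong (leaf ∷_)) (forests-complete zero k v (suc-injective eq)))
forests-complete zero    (suc k) (node a b ∷ v)   eq = ⊥-elim (<⇒≱ (s≤s ≤-refl) (begin
  2 + k                           ≤⟨ +-mono-≤ (+-mono-≤ (1≤size a) (1≤size b)) (k≤totalSize v) ⟩
  totalSize (node a b ∷ v)        ≡⟨ eq ⟩
  suc k                           ∎))
  where open ≤-Reasoning
forests-complete (suc q) (suc k) (leaf ∷ v)       eq = Any.++⁺ˡ (Any.map⁺ (Any.map (cong (leaf ∷_))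
  (forests-complete (suc q) k v (suc-injective (trans eq (+-suc (suc q) k))))))
forests-complete (suc q) (suc k) (node a b ∷ v)   eq = Any.++⁺ʳ (map (leaf ∷_) (forests (suc q) k))
  (Any.map⁺ (Any.map (cong joinFirst) (forests-complete q (2 + k) (a ∷ b ∷ v)
    (trans (sym (+-assoc (size a) (size b) (totalSize v))) (trans eq (sym (+-suc q (suc k))))))))

forests-unique : ∀ q k → Unique (forests q k)
forests-unique zero    zero    = [] ∷ []
forests-unique (suc q) zero    = []
forests-unique zero    (suc k) =
  AllPairs.map⁺ (AllPairs.map (λ ne → ne ∘ Vec.∷-injectiveʳ) (forests-unique zero k))
forests-unique (suc q) (suc k) = AllPairs.++⁺
  (AllPairs.map⁺ (AllPairs.map (λ ne → ne ∘ Vec.∷-injectiveʳ) (forests-unique (suc q) k)))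
  (AllPairs.map⁺ (AllPairs.map (λ {u} {w} ne → ne ∘ joinFirst-injective u w) (forests-unique q (2 + k))))
  (All.map⁺ (All.universal (λ u → All.map⁺ (All.universal (leaf≢joinFirst u) _)) _))
  where
  leaf≢joinFirst : ∀ u (w : Vec Shape (2 + k)) → leaf ∷ u ≢ joinFirst w
  leaf≢joinFirst u (a ∷ b ∷ w) ()

length-forests-zero : ∀ k → length (forests zero k) ≡ 1
length-forests-zero zero    = refl
length-forests-zero (suc k) = trans (length-map (leaf ∷_) (forests zero k)) (length-forests-zero k)

length-forests-suc : ∀ q k →
  length (forests (suc q) (suc k)) ≡ length (forests (suc q) k) + length (forests q (2 + k))
length-forests-suc q k = trans (length-++ (map (leaf ∷_) (forests (suc q) k)))
  (cong₂ _+_ (length-map _ (forests (suc q) k)) (length-map joinFirst (forests q (2 + k))))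

-- n C (q ∸ 1), except that it is 0 (not n C 0) for q = 0.
infixl 6.5 _C⁻_

_C⁻_ : ℕ → ℕ → ℕ
n C⁻ zero  = 0
n C⁻ suc q = n C q

C⁻-pascal : ∀ n q → suc n C q ≡ n C⁻ q + n C q
C⁻-pascal n zero    = refl
C⁻-pascal n (suc q) = sym (nCk+nC[k+1]≡[n+1]C[k+1] n q)

C-middle-symmetric : ∀ {n r} → n ≡ r + r + 1 → n C suc r ≡ n C r
C-middle-symmetric {r = r} refl = trans (nCk≡nC[n∸k] r+1≤n) (cong (n C_) n∸[r+1]≡r)
  where
  n = r + r + 1
  n≡[r+1]+r : n ≡ suc r + r
  n≡[r+1]+r = +-comm (r + r) 1
  r+1≤n : suc r ≤ n
  r+1≤n = subst (suc r ≤_) (sym n≡[r+1]+r) (m≤m+n (suc r) r)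
  n∸[r+1]≡r : n ∸ suc r ≡ r
  n∸[r+1]≡r = trans (cong (_∸ suc r) n≡[r+1]+r) (m+n∸m≡n (suc r) r)

-- The ballot numbers: |forests q (1 + j)| = n C q − n C (q − 1) for n = 2q + j.
length-forests : ∀ q j n → n ≡ q + q + j → length (forests q (suc j)) + n C⁻ q ≡ n C q
length-forests zero    j       n       eq = trans (+-identityʳ _) (length-forests-zero (suc j))
length-forests (suc r) zero    (suc n) eq = begin
  length (forests (suc r) 1) + suc n C r   ≡⟨ cong₂ _+_ (length-forests-suc r 0) (C⁻-pascal n r) ⟩
  length (forests r 2) + (n C⁻ r + n C r)  ≡⟨ +-assoc (length (forests r 2)) _ _ ⟨
  length (forests r 2) + n C⁻ r + n C r    ≡⟨ cong (_+ n C r) (length-forests r 1 n n≡2r+1) ⟩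
  n C r + n C r                            ≡⟨ cong (n C r +_) (C-middle-symmetric n≡2r+1) ⟨
  n C r + n C suc r                        ≡⟨ nCk+nC[k+1]≡[n+1]C[k+1] n r ⟩
  suc n C suc r                            ∎
  where
  open ≡-Reasoning
  shift₀ : ∀ r → r + suc r + 0 ≡ r + r + 1
  shift₀ = solve-∀
  n≡2r+1 : n ≡ r + r + 1
  n≡2r+1 = trans (suc-injective eq) (shift₀ r)
length-forests (suc r) (suc j) (suc n) eq = begin
  length (forests (suc r) (2 + j)) + suc n C r
    ≡⟨ cong₂ _+_ (length-forests-suc r (suc j)) (C⁻-pascal n r) ⟩
  (a + b) + (n C⁻ r + n C r)
    ≡⟨ regroup a b (n C⁻ r) (n C r) ⟩
  (a + n C r) + (b + n C⁻ r)
    ≡⟨ cong₂ _+_ (length-forests (suc r) j n n≡2[r+1]+j) (length-forests r (2 + j) n n≡2r+[j+2]) ⟩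
  n C suc r + n C r
    ≡⟨ +-comm (n C suc r) _ ⟩
  n C r + n C suc r
    ≡⟨ nCk+nC[k+1]≡[n+1]C[k+1] n r ⟩
  suc n C suc r
    ∎
  where
  open ≡-Reasoning
  a = length (forests (suc r) (suc j))
  b = length (forests r (3 + j))
  regroup : ∀ a b c d → (a + b) + (c + d) ≡ (a + d) + (b + c)
  regroup = solve-∀
  shift₁ : ∀ r j → r + suc r + suc j ≡ suc r + suc r + j
  shift₁ = solve-∀
  shift₂ : ∀ r j → r + suc r + suc j ≡ r + r + (2 + j)
  shift₂ = solve-∀
  n≡2[r+1]+j : n ≡ suc r + suc r + j
  n≡2[r+1]+j = trans (suc-injective eq) (shift₁ r j)
  n≡2r+[j+2] : n ≡ r + r + (2 + j)
  n≡2r+[j+2] = trans (suc-injective eq) (shift₂ r j)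

nCk*[k!*[n∸k]!]≡n! : ∀ {n k} → k ≤ n → (n C k) * (k ! * (n ∸ k) !) ≡ n !
nCk*[k!*[n∸k]!]≡n! {n} {k} k≤n = trans (cong (_* (k ! * (n ∸ k) !)) (nCk≡n!/k![n-k]! k≤n))
  (m/n*n≡m {{k !* (n ∸ k) !≢0}} (k![n∸k]!∣n! k≤n))

nC[k+1]*[k+1]≡nCk*[n∸k] : ∀ {n k} → k < n → (n C suc k) * suc k ≡ (n C k) * (n ∸ k)
nC[k+1]*[k+1]≡nCk*[n∸k] {suc n} {k} (s≤s k≤n) =
  *-cancelʳ-≡ _ _ (k ! * (n ∸ k) !) {{k !* (n ∸ k) !≢0}} (begin
    A * suc k * (k ! * (n ∸ k) !)          ≡⟨ regroup A (suc k) (k !) ((n ∸ k) !) ⟩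
    A * (suc k * k ! * (n ∸ k) !)          ≡⟨ nCk*[k!*[n∸k]!]≡n! (s≤s k≤n) ⟩
    suc n !                                ≡⟨ nCk*[k!*[n∸k]!]≡n! (m≤n⇒m≤1+n k≤n) ⟨
    B * (k ! * (suc n ∸ k) !)              ≡⟨ cong (λ m → B * (k ! * m !)) 1+n∸k≡1+[n∸k] ⟩
    B * (k ! * (suc (n ∸ k) * (n ∸ k) !))  ≡⟨ regroup′ B (suc (n ∸ k)) (k !) ((n ∸ k) !) ⟩
    B * suc (n ∸ k) * (k ! * (n ∸ k) !)    ≡⟨ cong (λ m → B * m * (k ! * (n ∸ k) !)) 1+n∸k≡1+[n∸k] ⟨
    B * (suc n ∸ k) * (k ! * (n ∸ k) !)    ∎)
  where
  open ≡-Reasoning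
  A = suc n C suc k
  B = suc n C k
  1+n∸k≡1+[n∸k] : suc n ∸ k ≡ suc (n ∸ k)
  1+n∸k≡1+[n∸k] = +-∸-assoc 1 k≤n
  regroup : ∀ a b c d → a * b * (c * d) ≡ a * (b * c * d)
  regroup = solve-∀
  regroup′ : ∀ a b c d → a * (c * (b * d)) ≡ a * b * (c * d)
  regroup′ = solve-∀

length-forests≡Catalan : ∀ m → length (forests m 1) ≡ Catalan m
length-forests≡Catalan zero    = refl
length-forests≡Catalan (suc r) = sym (begin
  Catalan m                  ≡⟨ /-congˡ (cong (λ k → (m + k) C m) (+-identityʳ m)) ⟩
  ((m + m) C m) / suc m      ≡⟨ /-congˡ X*[m+1]≡A ⟨
  (X * suc m) / suc m        ≡⟨ m*n/n≡m X (suc m) ⟩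
  X                          ∎)
  where
  open ≡-Reasoning
  m = suc r
  X = length (forests m 1)
  A = (m + m) C m
  B = (m + m) C r
  X+B≡A : X + B ≡ A
  X+B≡A = length-forests m 0 (m + m) (sym (+-identityʳ (m + m)))
  B*[m+1]≡A*m : B * suc m ≡ A * m
  B*[m+1]≡A*m = begin
    B * suc m            ≡⟨ cong (B *_) (m+n∸m≡n r (suc m)) ⟨
    B * (r + suc m ∸ r)  ≡⟨ cong (λ k → B * (k ∸ r)) (+-suc r m) ⟩
    B * (m + m ∸ r)      ≡⟨ nC[k+1]*[k+1]≡nCk*[n∸k] (m≤n+m m m) ⟨
    A * m                ∎
  X*[m+1]≡A : X * suc m ≡ A
  X*[m+1]≡A = +-cancelʳ-≡ (A * m) _ _ (begin
    X * suc m + A * m        ≡⟨ cong (X * suc m +_) B*[m+1]≡A*m ⟨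
    X * suc m + B * suc m    ≡⟨ *-distribʳ-+ (suc m) X B ⟨
    (X + B) * suc m          ≡⟨ cong (_* suc m) X+B≡A ⟩
    A * suc m                ≡⟨ *-suc A m ⟩
    A + A * m                ∎)

oddFactorial : ℕ → ℕ
oddFactorial zero    = 1
oddFactorial (suc m) = oddFactorial m * suc (2 * m)

oddFactorial*2^m*m!≡[2m]! : ∀ m → oddFactorial m * (2 ^ m * m !) ≡ (2 * m) !
oddFactorial*2^m*m!≡[2m]! zero    = refl
oddFactorial*2^m*m!≡[2m]! (suc m) = begin
  oddFactorial m * suc (2 * m) * (2 * 2 ^ m * (suc m * m !))
    ≡⟨ regroup (oddFactorial m) m (2 ^ m) (m !) ⟩
  (2 + 2 * m) * (suc (2 * m) * (oddFactorial m * (2 ^ m * m !)))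
    ≡⟨ cong (λ k → (2 + 2 * m) * (suc (2 * m) * k)) (oddFactorial*2^m*m!≡[2m]! m) ⟩
  (2 + 2 * m) !
    ≡⟨ cong _! (*-distribˡ-+ 2 1 m) ⟨
  (2 * suc m) !
    ∎
  where
  open ≡-Reasoning
  regroup : ∀ o m p f →
    o * suc (2 * m) * (2 * p * (suc m * f)) ≡ (2 + 2 * m) * (suc (2 * m) * (o * (p * f)))
  regroup = solve-∀

oddFactorial≡D : ∀ m → oddFactorial m ≡ D m
oddFactorial≡D m = sym (trans (/-congˡ {{2^m*m!≢0}} (sym (oddFactorial*2^m*m!≡[2m]! m)))
  (m*n/n≡m (oddFactorial m) (2 ^ m * m !) {{2^m*m!≢0}}))
  where
  2^m*m!≢0 : NonZero (2 ^ m * m !)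
  2^m*m!≢0 = m*n≢0 (2 ^ m) (m !) {{m^n≢0 2 m}} {{m !≢0}}

shapes : ℕ → List Shape
shapes m = map head (forests m 1)

length-shapes : ∀ m → length (shapes m) ≡ Catalan m
length-shapes m = trans (length-map head (forests m 1)) (length-forests≡Catalan m)

shapes-complete : ∀ m s → size s ≡ suc m → s ∈ shapes m
shapes-complete m s eq = Any.map⁺ (Any.map (cong head)
  (forests-complete m 1 (s ∷ []) (trans (+-identityʳ (size s)) (trans eq (+-comm 1 m)))))

shapes-size : ∀ m → All (λ s → size s ≡ suc m) (shapes m)
shapes-size m = All.map⁺ (All.map (λ {v} → size-head v) (forests-totalSize m 1))
  where
  size-head : ∀ (v : Vec Shape 1) → totalSize v ≡ m + 1 → size (head v) ≡ suc m
  size-head (s ∷ []) eq = trans (sym (+-identityʳ (size s))) (trans eq (+-comm m 1))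

shapes-unique : ∀ m → Unique (shapes m)
shapes-unique m = Unique.map⁺ head-injective (forests-unique m 1)
  where
  head-injective : ∀ {u w : Vec Shape 1} → head u ≡ head w → u ≡ w
  head-injective {_ ∷ []} {_ ∷ []} refl = refl

-- Terms up to commutativity

module _ {n : ℕ} where

  leftmost : Term n → Fin n
  leftmost (var i) = i
  leftmost (a · b) = leftmost a

  leftmost∈leaves : ∀ (t : Term n) → leftmost t ∈ leaves t
  leftmost∈leaves (var i) = here refl
  leftmost∈leaves (a · b) = Any.++⁺ˡ (leftmost∈leaves a)

  1≤length-leaves : ∀ (t : Term n) → 1 ≤ length (leaves t)
  1≤length-leaves (var i) = s≤s z≤n
  1≤length-leaves (a · b) =
    ≤-trans (1≤length-leaves a) (≤-trans (m≤m+n _ _) (≤-reflexive (sym (length-++ (leaves a)))))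

  2≤length-leaves : ∀ (a b : Term n) → 2 ≤ length (leaves (a · b))
  2≤length-leaves a b =
    ≤-trans (+-mono-≤ (1≤length-leaves a) (1≤length-leaves b)) (≤-reflexive (sym (length-++ (leaves a))))

  var-unique : ∀ x (t : Term n) → leaves t ↭ [ x ] → t ≡ var x
  var-unique x (var i) p with ↭-singleton-inv p
  ... | refl = refl
  var-unique x (a · b) p = ⊥-elim (<⇒≱ (2≤length-leaves a b) (≤-reflexive (↭-length p)))

  infix 4 _≟ᵀ_

  _≟ᵀ_ : (s t : Term n) → Dec (s ≡ t)
  var i   ≟ᵀ var j   = Dec.map′ (cong var) (λ { refl → refl }) (i Fin.≟ j)
  var i   ≟ᵀ (_ · _) = no λ ()
  (_ · _) ≟ᵀ var j   = no λ ()
  (a · b) ≟ᵀ (c · d) =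
    Dec.map′ (λ (a≡c , b≡d) → cong₂ _·_ a≡c b≡d) (λ { refl → refl , refl }) ((a ≟ᵀ c) ×-dec (b ≟ᵀ d))

module _ {n : ℕ} where

  infix 4 _≈ᶜ_

  data _≈ᶜ_ : Term n → Term n → Set where
    ≈-refl  : ∀ {t} → t ≈ᶜ t
    ≈-trans : ∀ {s t u} → s ≈ᶜ t → t ≈ᶜ u → s ≈ᶜ u
    ≈-swap  : ∀ a b → a · b ≈ᶜ b · a
    ≈-cong  : ∀ {a a′ b b′} → a ≈ᶜ a′ → b ≈ᶜ b′ → a · b ≈ᶜ a′ · b′

  insertions : Term n → Term n → List (Term n)
  insertions v (var i) = (var i · v) ∷ []
  insertions v (a · b) = ((a · b) · v) ∷ map (_· b) (insertions v a) ++ map (a ·_) (insertions v b)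

  ≈-insertions-head : ∀ v b {s} → s ≈ᶜ b · v → Any (s ≈ᶜ_) (insertions v b)
  ≈-insertions-head v (var i) s≈ = here s≈
  ≈-insertions-head v (a · b) s≈ = here s≈

  insertions-resp-≈ᶜ : ∀ v {s t} → s ≈ᶜ t →
    All (λ w → Any (w ≈ᶜ_) (insertions v t)) (insertions v s)
  insertions-resp-≈ᶜ v ≈-refl = All.tabulate (Any.map (λ { refl → ≈-refl }))
  insertions-resp-≈ᶜ v (≈-trans p q) = All.map
    (All.lookupWith (λ r≈ w≈r → Any.map (≈-trans w≈r) r≈) (insertions-resp-≈ᶜ v q))
    (insertions-resp-≈ᶜ v p)
  insertions-resp-≈ᶜ v (≈-swap a b) = here (≈-cong (≈-swap a b) ≈-refl) ∷ All.++⁺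
    (All.map⁺ (All.tabulate (λ w∈ → there (Any.++⁺ʳ (map (_· a) (insertions v b))
      (Any.map⁺ (Any.map (λ { refl → ≈-swap _ b }) w∈))))))
    (All.map⁺ (All.tabulate (λ w∈ → there (Any.++⁺ˡ
      (Any.map⁺ (Any.map (λ { refl → ≈-swap a _ }) w∈))))))
  insertions-resp-≈ᶜ v (≈-cong {a} {a′} {b} {b′} p q) = here (≈-cong (≈-cong p q) ≈-refl) ∷ All.++⁺
    (All.map⁺ (All.map (λ w≈ → there (Any.++⁺ˡ (Any.map⁺ (Any.map (λ r → ≈-cong r q) w≈))))
      (insertions-resp-≈ᶜ v p)))
    (All.map⁺ (All.map (λ w≈ → there (Any.++⁺ʳ (map (_· b′) (insertions v a′))
      (Any.map⁺ (Any.map (≈-cong p) w≈)))) (insertions-resp-≈ᶜ v q)))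

  leaves-insertions : ∀ v a → All (λ w → leaves w ↭ leaves v ++ leaves a) (insertions v a)
  leaves-insertions v (var i) = ++-comm [ i ] (leaves v) ∷ []
  leaves-insertions v (a · b) = ++-comm (leaves a ++ leaves b) (leaves v) ∷ All.++⁺
    (All.map⁺ (All.map (λ p → ↭-trans (++⁺ʳ (leaves b) p) (↭-reflexive (++-assoc (leaves v) (leaves a) (leaves b))))
      (leaves-insertions v a)))
    (All.map⁺ (All.map (λ p → ↭-trans (++⁺ˡ (leaves a) p) (shifts (leaves a) (leaves v)))
      (leaves-insertions v b)))

  length-insertions : ∀ v a → suc (length (insertions v a)) ≡ 2 * length (leaves a)
  length-insertions v (var i) = refl
  length-insertions v (a · b) = begin
    2 + length (map (_· b) (insertions v a) ++ map (a ·_) (insertions v b))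
      ≡⟨ cong (2 +_) (length-++ (map (_· b) (insertions v a))) ⟩
    2 + (length (map (_· b) (insertions v a)) + length (map (a ·_) (insertions v b)))
      ≡⟨ cong₂ (λ k l → 2 + (k + l)) (length-map _ (insertions v a)) (length-map _ (insertions v b)) ⟩
    2 + (length (insertions v a) + length (insertions v b))
      ≡⟨ cong suc (+-suc (length (insertions v a)) _) ⟨
    suc (length (insertions v a)) + suc (length (insertions v b))
      ≡⟨ cong₂ _+_ (length-insertions v a) (length-insertions v b) ⟩
    2 * length (leaves a) + 2 * length (leaves b)
      ≡⟨ *-distribˡ-+ 2 (length (leaves a)) (length (leaves b)) ⟨
    2 * (length (leaves a) + length (leaves b))
      ≡⟨ cong (2 *_) (length-++ (leaves a)) ⟨
    2 * length (leaves (a · b))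
      ∎
    where open ≡-Reasoning

  Detachable : Fin n → Term n → Set
  Detachable x t = Σ[ u ∈ Term n ] (x ∷ leaves u ↭ leaves t) × Any (t ≈ᶜ_) (insertions (var x) u)

  detach : ∀ x (t : Term n) → x ∈ leaves t → t ≡ var x ⊎ Detachable x t
  detach x (var i) (here refl) = inj₁ refl
  detach x (a · b) x∈ with Any.++⁻ (leaves a) x∈
  ... | inj₁ x∈a with detach x a x∈a
  ...   | inj₁ refl = inj₂ (b , ↭-refl , ≈-insertions-head (var x) b (≈-swap (var x) b))
  ...   | inj₂ (u , p , q) = inj₂ (u · b , ++⁺ʳ (leaves b) p ,
          there (Any.++⁺ˡ (Any.map⁺ (Any.map (λ r → ≈-cong r ≈-refl) q))))
  detach x (a · b) x∈ | inj₂ x∈b with detach x b x∈b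
  ...   | inj₁ refl = inj₂ (a , ++-comm [ x ] (leaves a) , ≈-insertions-head (var x) a ≈-refl)
  ...   | inj₂ (u , p , q) = inj₂ (a · u ,
          ↭-trans (↭-sym (shift x (leaves a) (leaves u))) (++⁺ˡ (leaves a) p) ,
          there (Any.++⁺ʳ (map (_· u) (insertions (var x) a)) (Any.map⁺ (Any.map (≈-cong ≈-refl) q))))

  linearTerms : Fin n → List (Fin n) → List (Term n)
  linearTerms x []       = [ var x ]
  linearTerms x (y ∷ ys) = concatMap (insertions (var x)) (linearTerms y ys)

  leaves-linearTerms : ∀ x xs → All (λ r → leaves r ↭ x ∷ xs) (linearTerms x xs)
  leaves-linearTerms x []       = ↭-refl ∷ []
  leaves-linearTerms x (y ∷ ys) = All.concat⁺ (All.map⁺ (All.map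
    (λ {r} p → All.map (λ q → ↭-trans q (↭-prep x p)) (leaves-insertions (var x) r))
    (leaves-linearTerms y ys)))

  length-linearTerms : ∀ x xs → length (linearTerms x xs) ≡ oddFactorial (length xs)
  length-linearTerms x []       = refl
  length-linearTerms x (y ∷ ys) = begin
    length (concatMap (insertions (var x)) (linearTerms y ys))
      ≡⟨ length-concatMap (insertions (var x)) (linearTerms y ys)
           (All.map (λ {r} → length-ins {r}) (leaves-linearTerms y ys)) ⟩
    length (linearTerms y ys) * suc (2 * length ys)
      ≡⟨ cong (_* suc (2 * length ys)) (length-linearTerms y ys) ⟩
    oddFactorial (length (y ∷ ys))
      ∎
    where
    open ≡-Reasoning
    length-ins : ∀ {r} → leaves r ↭ y ∷ ys → length (insertions (var x) r) ≡ suc (2 * length ys)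
    length-ins {r} p = suc-injective (begin
      suc (length (insertions (var x) r))  ≡⟨ length-insertions (var x) r ⟩
      2 * length (leaves r)                ≡⟨ cong (2 *_) (↭-length p) ⟩
      2 * suc (length ys)                  ≡⟨ *-suc 2 (length ys) ⟩
      suc (suc (2 * length ys))            ∎)

  linearTerms-complete : ∀ x xs (t : Term n) → leaves t ↭ x ∷ xs → Any (t ≈ᶜ_) (linearTerms x xs)
  linearTerms-complete x []       t p = here (subst (t ≈ᶜ_) (var-unique x t p) ≈-refl)
  linearTerms-complete x (y ∷ ys) t p with detach x t (∈-resp-↭ (↭-sym p) (here refl))
  ... | inj₁ refl with () ← ↭-length p
  ... | inj₂ (u , x∷u↭t , t≈) = Any.concatMap⁺ (insertions (var x)) (Any.map
    (λ u≈r → All.lookupWith (λ r≈ t≈w → Any.map (≈-trans t≈w) r≈) (insertions-resp-≈ᶜ (var x) u≈r) t≈)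
    (linearTerms-complete y ys u (drop-∷ (↭-trans x∷u↭t p))))

module _ {n : ℕ} where

  shape : Term n → Shape
  shape (var i) = leaf
  shape (a · b) = node (shape a) (shape b)

  -- The default variable d is a junk value, used only if the list is too short.
  fill : Fin n → Shape → List (Fin n) → Term n
  fill d leaf       []      = var d
  fill d leaf       (x ∷ _) = var x
  fill d (node a b) xs      = fill d a (take (size a) xs) · fill d b (drop (size a) xs)

  size-shape : ∀ (t : Term n) → size (shape t) ≡ length (leaves t)
  size-shape (var i) = refl
  size-shape (a · b) = trans (cong₂ _+_ (size-shape a) (size-shape b)) (sym (length-++ (leaves a)))

  fill-shape : ∀ d (t : Term n) → fill d (shape t) (leaves t) ≡ t
  fill-shape d (var i) = refl
  fill-shape d (a · b)
    rewrite size-shape a | take-length-++ (leaves a) (leaves b) | drop-length-++ (leaves a) (leaves b) =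
    cong₂ _·_ (fill-shape d a) (fill-shape d b)

  shape-fill : ∀ d s xs → shape (fill d s xs) ≡ s
  shape-fill d leaf       []      = refl
  shape-fill d leaf       (x ∷ _) = refl
  shape-fill d (node a b) xs      = cong₂ node (shape-fill d a _) (shape-fill d b _)

  leaves-fill : ∀ d s xs → length xs ≡ size s → leaves (fill d s xs) ≡ xs
  leaves-fill d leaf       (x ∷ []) eq = refl
  leaves-fill d (node a b) xs       eq =
    trans (cong₂ _++_ (leaves-fill d a _ length-take-a) (leaves-fill d b _ length-drop-a))
          (take++drop≡id (size a) xs)
    where
    length-take-a : length (take (size a) xs) ≡ size a
    length-take-a =
      trans (length-take (size a) xs) (m≤n⇒m⊓n≡m (subst (size a ≤_) (sym eq) (m≤m+n _ _)))
    length-drop-a : length (drop (size a) xs) ≡ size b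
    length-drop-a =
      trans (length-drop (size a) xs) (trans (cong (_∸ size a) eq) (m+n∸m≡n (size a) (size b)))

length-allFin : ∀ n → length (allFin n) ≡ n
length-allFin n = length-tabulate (λ i → i)

bracketings : ∀ m → List (Term (suc m))
bracketings m = map (λ s → fill zero s (allFin (suc m))) (shapes m)

length-bracketings : ∀ m → length (bracketings m) ≡ Catalan m
length-bracketings m = trans (length-map _ (shapes m)) (length-shapes m)

bracketings-Bracketing : ∀ m → All Bracketing (bracketings m)
bracketings-Bracketing m = All.map⁺ (All.map
  (λ {s} size≡ → leaves-fill zero s (allFin (suc m)) (trans (length-allFin (suc m)) (sym size≡)))
  (shapes-size m))

bracketings-complete : ∀ m (t : Term (suc m)) → Bracketing t → t ∈ bracketings m
bracketings-complete m t t-brk = Any.map⁺ (Any.map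
  (λ { refl → trans (sym (fill-shape zero t)) (cong (fill zero (shape t)) t-brk) })
  (shapes-complete m (shape t) (trans (size-shape t) (trans (cong length t-brk) (length-allFin (suc m))))))

bracketings-unique : ∀ m → Unique (bracketings m)
bracketings-unique m = Unique.map⁺ (λ {s} {s′} eq →
  trans (sym (shape-fill zero s _)) (trans (cong shape eq) (shape-fill zero s′ _))) (shapes-unique m)

spine : ℕ → Shape
spine zero    = leaf
spine (suc k) = node leaf (spine k)

size-spine : ∀ k → size (spine k) ≡ suc k
size-spine zero    = refl
size-spine (suc k) = cong suc (size-spine k)

spineBracketing : ∀ m → Term (suc m)
spineBracketing m = fill zero (spine m) (allFin (suc m))

spineBracketing-Bracketing : ∀ m → Bracketing (spineBracketing m)
spineBracketing-Bracketing m =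
  leaves-fill zero (spine m) (allFin (suc m)) (trans (length-allFin (suc m)) (sym (size-spine m)))

fullLinearTerms : ∀ m → List (Term (suc m))
fullLinearTerms m = linearTerms zero (tabulate suc)

length-fullLinearTerms : ∀ m → length (fullLinearTerms m) ≡ D m
length-fullLinearTerms m = trans (length-linearTerms {suc m} zero (tabulate suc))
  (trans (cong oddFactorial (length-tabulate {n = m} suc)) (oddFactorial≡D m))

-- Term operations of a commutative groupoid with identity

module Semantics {G : Set} (_∙_ : Op₂ G) (e : G)
  (comm : Commutative _≡_ _∙_) (identity : Identity _≡_ e _∙_) where

  idˡ : LeftIdentity _≡_ e _∙_
  idˡ = proj₁ identity

  idʳ : RightIdentity _≡_ e _∙_
  idʳ = proj₂ identity

  module _ {n : ℕ} where

    eval : Term n → (Fin n → G) → G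
    eval t = ⟦ t ⟧ _∙_

    ≈ᶜ⇒SameOp : ∀ {s t : Term n} → s ≈ᶜ t → SameOp _∙_ s t
    ≈ᶜ⇒SameOp ≈-refl        ρ = refl
    ≈ᶜ⇒SameOp (≈-trans p q) ρ = trans (≈ᶜ⇒SameOp p ρ) (≈ᶜ⇒SameOp q ρ)
    ≈ᶜ⇒SameOp (≈-swap a b)  ρ = comm _ _
    ≈ᶜ⇒SameOp (≈-cong p q)  ρ = cong₂ _∙_ (≈ᶜ⇒SameOp p ρ) (≈ᶜ⇒SameOp q ρ)

    eval-local : ∀ (t : Term n) ρ σ → (∀ {i} → i ∈ leaves t → ρ i ≡ σ i) →
      eval t ρ ≡ eval t σ
    eval-local (var i) ρ σ ρ≡σ = ρ≡σ (here refl)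
    eval-local (a · b) ρ σ ρ≡σ =
      cong₂ _∙_ (eval-local a ρ σ (ρ≡σ ∘ Any.++⁺ˡ)) (eval-local b ρ σ (ρ≡σ ∘ Any.++⁺ʳ (leaves a)))

    eval-≡e : ∀ (t : Term n) ρ → (∀ {i} → i ∈ leaves t → ρ i ≡ e) → eval t ρ ≡ e
    eval-≡e (var i) ρ ρ≡e = ρ≡e (here refl)
    eval-≡e (a · b) ρ ρ≡e = trans
      (cong₂ _∙_ (eval-≡e a ρ (ρ≡e ∘ Any.++⁺ˡ)) (eval-≡e b ρ (ρ≡e ∘ Any.++⁺ʳ (leaves a))))
      (idˡ e)

    eval-point : ∀ (t : Term n) ρ {α} → Unique (leaves t) → α ∈ leaves t →
      (∀ {i} → i ∈ leaves t → i ≢ α → ρ i ≡ e) → eval t ρ ≡ ρ α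
    eval-point (var i) ρ u (here refl) ρ≡e = refl
    eval-point (a · b) ρ u α∈ ρ≡e with Any.++⁻ (leaves a) α∈
    ... | inj₁ α∈a = trans (cong₂ _∙_
          (eval-point a ρ (Unique-++⁻ˡ (leaves a) u) α∈a (ρ≡e ∘ Any.++⁺ˡ))
          (eval-≡e b ρ (λ i∈b → ρ≡e (Any.++⁺ʳ (leaves a) i∈b)
            (≢-sym (Unique-++⇒≢ (leaves a) u α∈a i∈b)))))
          (idʳ _)
    ... | inj₂ α∈b = trans (cong₂ _∙_
          (eval-≡e a ρ (λ i∈a → ρ≡e (Any.++⁺ˡ i∈a) (Unique-++⇒≢ (leaves a) u i∈a α∈b)))
          (eval-point b ρ (Unique-++⁻ʳ (leaves a) u) α∈b (ρ≡e ∘ Any.++⁺ʳ (leaves a))))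
          (idˡ _)

    eval-twoPoints : ∀ (t : Term n) ρ {α β} → Unique (leaves t) →
      α ∈ leaves t → β ∈ leaves t → α ≢ β →
      (∀ {i} → i ∈ leaves t → i ≢ α → i ≢ β → ρ i ≡ e) → eval t ρ ≡ ρ α ∙ ρ β
    eval-twoPoints (var i) ρ u (here refl) (here refl) α≢β ρ≡e = ⊥-elim (α≢β refl)
    eval-twoPoints (a · b) ρ {α} {β} u α∈ β∈ α≢β ρ≡e =
      cases (Any.++⁻ (leaves a) α∈) (Any.++⁻ (leaves a) β∈)
      where
      ua = Unique-++⁻ˡ (leaves a) u
      ub = Unique-++⁻ʳ (leaves a) u
      a≢b : ∀ {i j} → i ∈ leaves a → j ∈ leaves b → i ≢ j
      a≢b = Unique-++⇒≢ (leaves a) u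
      cases : α ∈ leaves a ⊎ α ∈ leaves b → β ∈ leaves a ⊎ β ∈ leaves b →
        eval (a · b) ρ ≡ ρ α ∙ ρ β
      cases (inj₁ α∈a) (inj₁ β∈a) = trans (cong₂ _∙_
        (eval-twoPoints a ρ ua α∈a β∈a α≢β (ρ≡e ∘ Any.++⁺ˡ))
        (eval-≡e b ρ (λ i∈b → ρ≡e (Any.++⁺ʳ (leaves a) i∈b) (≢-sym (a≢b α∈a i∈b)) (≢-sym (a≢b β∈a i∈b)))))
        (idʳ _)
      cases (inj₂ α∈b) (inj₂ β∈b) = trans (cong₂ _∙_
        (eval-≡e a ρ (λ i∈a → ρ≡e (Any.++⁺ˡ i∈a) (a≢b i∈a α∈b) (a≢b i∈a β∈b)))
        (eval-twoPoints b ρ ub α∈b β∈b α≢β (ρ≡e ∘ Any.++⁺ʳ (leaves a))))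
        (idˡ _)
      cases (inj₁ α∈a) (inj₂ β∈b) = cong₂ _∙_
        (eval-point a ρ ua α∈a (λ i∈a i≢α → ρ≡e (Any.++⁺ˡ i∈a) i≢α (a≢b i∈a β∈b)))
        (eval-point b ρ ub β∈b (λ i∈b → ρ≡e (Any.++⁺ʳ (leaves a) i∈b) (≢-sym (a≢b α∈a i∈b))))
      cases (inj₂ α∈b) (inj₁ β∈a) = trans (cong₂ _∙_
        (eval-point a ρ ua β∈a (λ i∈a → ρ≡e (Any.++⁺ˡ i∈a) (a≢b i∈a α∈b)))
        (eval-point b ρ ub α∈b (λ i∈b i≢α → ρ≡e (Any.++⁺ʳ (leaves a) i∈b) i≢α (≢-sym (a≢b β∈a i∈b)))))
        (comm _ _)

    ⟨_↦_,_↦_,_↦_⟩ : Fin n → G → Fin n → G → Fin n → G → Fin n → G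
    ⟨ α ↦ p , β ↦ q , γ ↦ r ⟩ =
      updateAt (updateAt (updateAt (const e) γ (const r)) β (const q)) α (const p)

    module _ {α β γ : Fin n} {p q r : G} where

      ⟨⟩-at₁ : ⟨ α ↦ p , β ↦ q , γ ↦ r ⟩ α ≡ p
      ⟨⟩-at₁ = updateAt-updates α _

      ⟨⟩-at₂ : β ≢ α → ⟨ α ↦ p , β ↦ q , γ ↦ r ⟩ β ≡ q
      ⟨⟩-at₂ β≢α = trans (updateAt-minimal β α _ β≢α) (updateAt-updates β _)

      ⟨⟩-at₃ : γ ≢ α → γ ≢ β → ⟨ α ↦ p , β ↦ q , γ ↦ r ⟩ γ ≡ r
      ⟨⟩-at₃ γ≢α γ≢β =
        trans (updateAt-minimal γ α _ γ≢α) (trans (updateAt-minimal γ β _ γ≢β) (updateAt-updates γ _))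

      ⟨⟩-elsewhere : ∀ {i} → i ≢ α → i ≢ β → i ≢ γ → ⟨ α ↦ p , β ↦ q , γ ↦ r ⟩ i ≡ e
      ⟨⟩-elsewhere {i} i≢α i≢β i≢γ =
        trans (updateAt-minimal i α _ i≢α) (trans (updateAt-minimal i β _ i≢β) (updateAt-minimal i γ _ i≢γ))

    open import Data.List.Membership.DecPropositional (Fin._≟_ {n}) using (_∈?_)

    resetOn : List (Fin n) → (Fin n → G) → Fin n → G
    resetOn L ρ i with i ∈? L
    ... | yes _ = e
    ... | no  _ = ρ i

    resetOn-∈ : ∀ {L} ρ {i} → i ∈ L → resetOn L ρ i ≡ e
    resetOn-∈ {L} ρ {i} i∈ with i ∈? L
    ... | yes _  = refl
    ... | no i∉  = ⊥-elim (i∉ i∈)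

    resetOn-∉ : ∀ {L} ρ {i} → i ∉ L → resetOn L ρ i ≡ ρ i
    resetOn-∉ {L} ρ {i} i∉ with i ∈? L
    ... | yes i∈ = ⊥-elim (i∉ i∈)
    ... | no _   = refl

    SameOp-cancelʳ : ∀ w₁ w₂ (b₁ b₂ : Term n) →
      (∀ {i} → i ∈ leaves w₁ → i ∉ leaves b₁ ++ leaves b₂) →
      (∀ {i} → i ∈ leaves w₂ → i ∉ leaves b₁ ++ leaves b₂) →
      SameOp _∙_ (w₁ · b₁) (w₂ · b₂) → SameOp _∙_ w₁ w₂
    SameOp-cancelʳ w₁ w₂ b₁ b₂ w₁∉ w₂∉ same ρ = begin
      eval w₁ ρ          ≡⟨ eval-local w₁ ρ ρ′ (sym ∘ resetOn-∉ ρ ∘ w₁∉) ⟩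
      eval w₁ ρ′         ≡⟨ idʳ _ ⟨
      eval w₁ ρ′ ∙ e     ≡⟨ cong (eval w₁ ρ′ ∙_) (eval-≡e b₁ ρ′ (resetOn-∈ ρ ∘ Any.++⁺ˡ)) ⟨
      eval (w₁ · b₁) ρ′  ≡⟨ same ρ′ ⟩
      eval (w₂ · b₂) ρ′  ≡⟨ cong (eval w₂ ρ′ ∙_) (eval-≡e b₂ ρ′ (resetOn-∈ ρ ∘ Any.++⁺ʳ (leaves b₁))) ⟩
      eval w₂ ρ′ ∙ e     ≡⟨ idʳ _ ⟩
      eval w₂ ρ′         ≡⟨ eval-local w₂ ρ′ ρ (resetOn-∉ ρ ∘ w₂∉) ⟩
      eval w₂ ρ          ∎
      where
      open ≡-Reasoning
      ρ′ = resetOn (leaves b₁ ++ leaves b₂) ρ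

    SameOp-cancelˡ : ∀ w₁ w₂ (b₁ b₂ : Term n) →
      (∀ {i} → i ∈ leaves w₁ → i ∉ leaves b₁ ++ leaves b₂) →
      (∀ {i} → i ∈ leaves w₂ → i ∉ leaves b₁ ++ leaves b₂) →
      SameOp _∙_ (b₁ · w₁) (b₂ · w₂) → SameOp _∙_ w₁ w₂
    SameOp-cancelˡ w₁ w₂ b₁ b₂ w₁∉ w₂∉ same =
      SameOp-cancelʳ w₁ w₂ b₁ b₂ w₁∉ w₂∉ (λ ρ → trans (comm _ _) (trans (same ρ) (comm _ _)))

    eval-insertions-unit : ∀ (v a : Term n) ρ → eval v ρ ≡ e →
      All (λ w → eval w ρ ≡ eval a ρ) (insertions v a)
    eval-insertions-unit v (var i) ρ v≡e = trans (cong (ρ i ∙_) v≡e) (idʳ _) ∷ []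
    eval-insertions-unit v (a · b) ρ v≡e = trans (cong (eval (a · b) ρ ∙_) v≡e) (idʳ _) ∷ All.++⁺
      (All.map⁺ (All.map (cong (_∙ eval b ρ)) (eval-insertions-unit v a ρ v≡e)))
      (All.map⁺ (All.map (cong (eval a ρ ∙_)) (eval-insertions-unit v b ρ v≡e)))

    InsertedBeside : Term n → Term n → Term n → Set
    InsertedBeside v a w = Σ[ α ∈ Fin n ] α ∈ leaves a ×
      (∀ ρ → (∀ {i} → i ∈ leaves a → i ≢ α → ρ i ≡ e) → eval w ρ ≡ ρ α ∙ eval v ρ)

    insertions-beside : ∀ (v a : Term n) → Unique (leaves a) → All (InsertedBeside v a) (insertions v a)
    insertions-beside v (var i) u = (i , here refl , λ ρ _ → refl) ∷ []
    insertions-beside v (a · b) u =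
      (leftmost (a · b) , leftmost∈leaves (a · b) ,
        λ ρ ρ≡e → cong (_∙ eval v ρ) (eval-point (a · b) ρ u (leftmost∈leaves (a · b)) ρ≡e))
      ∷ All.++⁺ (All.map⁺ (All.map (λ {w} → inLeft {w}) (insertions-beside v a ua)))
                (All.map⁺ (All.map (λ {w} → inRight {w}) (insertions-beside v b ub)))
      where
      ua = Unique-++⁻ˡ (leaves a) u
      ub = Unique-++⁻ʳ (leaves a) u
      inLeft : ∀ {w} → InsertedBeside v a w → InsertedBeside v (a · b) (w · b)
      inLeft (α , α∈ , eval-w) = α , Any.++⁺ˡ α∈ , λ ρ ρ≡e → trans (cong₂ _∙_
        (eval-w ρ (ρ≡e ∘ Any.++⁺ˡ))
        (eval-≡e b ρ (λ i∈b → ρ≡e (Any.++⁺ʳ (leaves a) i∈b) (≢-sym (Unique-++⇒≢ (leaves a) u α∈ i∈b)))))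
        (idʳ _)
      inRight : ∀ {w} → InsertedBeside v b w → InsertedBeside v (a · b) (a · w)
      inRight (α , α∈ , eval-w) = α , Any.++⁺ʳ (leaves a) α∈ , λ ρ ρ≡e → trans (cong₂ _∙_
        (eval-≡e a ρ (λ i∈a → ρ≡e (Any.++⁺ˡ i∈a) (Unique-++⇒≢ (leaves a) u i∈a α∈)))
        (eval-w ρ (ρ≡e ∘ Any.++⁺ʳ (leaves a))))
        (idˡ _)

  [xy]z≡[xz]y⇒assoc : (∀ x y z → (x ∙ y) ∙ z ≡ (x ∙ z) ∙ y) → Associative _≡_ _∙_
  [xy]z≡[xz]y⇒assoc swap x y z = begin
    (x ∙ y) ∙ z  ≡⟨ cong (_∙ z) (comm x y) ⟩
    (y ∙ x) ∙ z  ≡⟨ swap y z x ⟨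
    (y ∙ z) ∙ x  ≡⟨ comm (y ∙ z) x ⟩
    x ∙ (y ∙ z)  ∎
    where open ≡-Reasoning

  [xz]y≡x[yz]⇒assoc : (∀ x y z → (x ∙ z) ∙ y ≡ x ∙ (y ∙ z)) → Associative _≡_ _∙_
  [xz]y≡x[yz]⇒assoc shift x y z = trans (shift x z y) (cong (x ∙_) (comm z y))

  module _ {n : ℕ} where

    Separated : Term n → Term n → Set
    Separated s t = SameOp _∙_ s t → Associative _≡_ _∙_

    module InsertionCases (x : Fin n) (a b : Term n) (u : Unique (leaves a ++ leaves b))
      (x∉ : x ∉ leaves a ++ leaves b) where

      a≢b : ∀ {i j} → i ∈ leaves a → j ∈ leaves b → i ≢ j
      a≢b = Unique-++⇒≢ (leaves a) u

      a≢x : ∀ {i} → i ∈ leaves a → i ≢ x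
      a≢x i∈a refl = x∉ (Any.++⁺ˡ i∈a)

      b≢x : ∀ {i} → i ∈ leaves b → i ≢ x
      b≢x i∈b refl = x∉ (Any.++⁺ʳ (leaves a) i∈b)

      ua : Unique (leaves a)
      ua = Unique-++⁻ˡ (leaves a) u

      ub : Unique (leaves b)
      ub = Unique-++⁻ʳ (leaves a) u

      insertion-into-a-∉b : ∀ w → leaves w ↭ x ∷ leaves a → ∀ {i} → i ∈ leaves w → i ∉ leaves b
      insertion-into-a-∉b w w↭ i∈w i∈b with ∈-resp-↭ w↭ i∈w
      ... | here refl = b≢x i∈b refl
      ... | there i∈a = a≢b i∈a i∈b refl

      insertion-into-b-∉a : ∀ w → leaves w ↭ x ∷ leaves b → ∀ {i} → i ∈ leaves w → i ∉ leaves a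
      insertion-into-b-∉a w w↭ i∈w i∈a with ∈-resp-↭ w↭ i∈w
      ... | here refl = a≢x i∈a refl
      ... | there i∈b = a≢b i∈a i∈b refl

      cancel-b : ∀ {w₁ w₂} → leaves w₁ ↭ x ∷ leaves a → leaves w₂ ↭ x ∷ leaves a →
        SameOp _∙_ (w₁ · b) (w₂ · b) → SameOp _∙_ w₁ w₂
      cancel-b {w₁} {w₂} ↭₁ ↭₂ = SameOp-cancelʳ w₁ w₂ b b
        (λ i∈ → ∉-++⁺ (insertion-into-a-∉b w₁ ↭₁ i∈) (insertion-into-a-∉b w₁ ↭₁ i∈))
        (λ i∈ → ∉-++⁺ (insertion-into-a-∉b w₂ ↭₂ i∈) (insertion-into-a-∉b w₂ ↭₂ i∈))

      cancel-a : ∀ {w₁ w₂} → leaves w₁ ↭ x ∷ leaves b → leaves w₂ ↭ x ∷ leaves b →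
        SameOp _∙_ (a · w₁) (a · w₂) → SameOp _∙_ w₁ w₂
      cancel-a {w₁} {w₂} ↭₁ ↭₂ = SameOp-cancelˡ w₁ w₂ a a
        (λ i∈ → ∉-++⁺ (insertion-into-b-∉a w₁ ↭₁ i∈) (insertion-into-b-∉a w₁ ↭₁ i∈))
        (λ i∈ → ∉-++⁺ (insertion-into-b-∉a w₂ ↭₂ i∈) (insertion-into-b-∉a w₂ ↭₂ i∈))

      module Env {α β} (α∈a : α ∈ leaves a) (β∈b : β ∈ leaves b) (p q r : G) where

        σ : Fin n → G
        σ = ⟨ α ↦ p , β ↦ q , x ↦ r ⟩

        σ-off-a : ∀ {i} → i ∈ leaves a → i ≢ α → σ i ≡ e
        σ-off-a i∈a i≢α = ⟨⟩-elsewhere i≢α (a≢b i∈a β∈b) (a≢x i∈a)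

        σ-off-b : ∀ {i} → i ∈ leaves b → i ≢ β → σ i ≡ e
        σ-off-b i∈b i≢β = ⟨⟩-elsewhere (≢-sym (a≢b α∈a i∈b)) i≢β (b≢x i∈b)

        σ-α : σ α ≡ p
        σ-α = ⟨⟩-at₁ {γ = x}

        σ-β : σ β ≡ q
        σ-β = ⟨⟩-at₂ {γ = x} (≢-sym (a≢b α∈a β∈b))

        eval-a : eval a σ ≡ p
        eval-a = trans (eval-point a σ ua α∈a σ-off-a) σ-α

        eval-b : eval b σ ≡ q
        eval-b = trans (eval-point b σ ub β∈b σ-off-b) σ-β

        σ-x : σ x ≡ r
        σ-x = ⟨⟩-at₃ (≢-sym (a≢x α∈a)) (≢-sym (b≢x β∈b))

      head-vs-left : ∀ {w} → InsertedBeside (var x) a w → Separated ((a · b) · var x) (w · b)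
      head-vs-left {w} (α , α∈a , eval-w) same = [xy]z≡[xz]y⇒assoc λ p q r →
        let open Env α∈a (leftmost∈leaves b) p q r in begin
        (p ∙ q) ∙ r               ≡⟨ cong₂ _∙_ (cong₂ _∙_ eval-a eval-b) σ-x ⟨
        eval ((a · b) · var x) σ  ≡⟨ same σ ⟩
        eval (w · b) σ            ≡⟨ cong₂ _∙_ (trans (eval-w σ σ-off-a) (cong₂ _∙_ σ-α σ-x)) eval-b ⟩
        (p ∙ r) ∙ q               ∎
        where open ≡-Reasoning

      head-vs-right : ∀ {w} → InsertedBeside (var x) b w → Separated ((a · b) · var x) (a · w)
      head-vs-right {w} (β , β∈b , eval-w) same p q r =
        let open Env (leftmost∈leaves a) β∈b p q r in begin
        (p ∙ q) ∙ r               ≡⟨ cong₂ _∙_ (cong₂ _∙_ eval-a eval-b) σ-x ⟨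
        eval ((a · b) · var x) σ  ≡⟨ same σ ⟩
        eval (a · w) σ            ≡⟨ cong₂ _∙_ eval-a (trans (eval-w σ σ-off-b) (cong₂ _∙_ σ-β σ-x)) ⟩
        p ∙ (q ∙ r)               ∎
        where open ≡-Reasoning

      left-vs-right : ∀ {w₁ w₂} → InsertedBeside (var x) a w₁ → InsertedBeside (var x) b w₂ →
        Separated (w₁ · b) (a · w₂)
      left-vs-right {w₁} {w₂} (α , α∈a , eval-w₁) (β , β∈b , eval-w₂) same =
        [xz]y≡x[yz]⇒assoc λ p q r →
        let open Env α∈a β∈b p q r in begin
        (p ∙ r) ∙ q       ≡⟨ cong₂ _∙_ (trans (eval-w₁ σ σ-off-a) (cong₂ _∙_ σ-α σ-x)) eval-b ⟨
        eval (w₁ · b) σ   ≡⟨ same σ ⟩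
        eval (a · w₂) σ   ≡⟨ cong₂ _∙_ eval-a (trans (eval-w₂ σ σ-off-b) (cong₂ _∙_ σ-β σ-x)) ⟩
        p ∙ (q ∙ r)       ∎
        where open ≡-Reasoning

    insertions-separated : ∀ x (a : Term n) → Unique (leaves a) → x ∉ leaves a →
      AllPairs Separated (insertions (var x) a)
    insertions-separated x (var i) _ _   = [] ∷ []
    insertions-separated x (a · b) u x∉ =
      All.++⁺ (All.map⁺ (All.map (λ {w} → head-vs-left {w}) (insertions-beside (var x) a ua)))
              (All.map⁺ (All.map (λ {w} → head-vs-right {w}) (insertions-beside (var x) b ub)))
      ∷ AllPairs.++⁺ left-pairs right-pairs cross-pairs
      where
      open InsertionCases x a b u x∉
      left-pairs : AllPairs Separated (map (_· b) (insertions (var x) a))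
      left-pairs = AllPairs.map⁺ (AllPairs-mapWith (λ {w₁} {w₂} ↭₁ ↭₂ sep → sep ∘ cancel-b {w₁} {w₂} ↭₁ ↭₂)
        (leaves-insertions (var x) a) (insertions-separated x a ua (x∉ ∘ Any.++⁺ˡ)))
      right-pairs : AllPairs Separated (map (a ·_) (insertions (var x) b))
      right-pairs = AllPairs.map⁺ (AllPairs-mapWith (λ {w₁} {w₂} ↭₁ ↭₂ sep → sep ∘ cancel-a {w₁} {w₂} ↭₁ ↭₂)
        (leaves-insertions (var x) b) (insertions-separated x b ub (x∉ ∘ Any.++⁺ʳ (leaves a))))
      cross-pairs : All (λ w₁ → All (Separated w₁) (map (a ·_) (insertions (var x) b)))
                        (map (_· b) (insertions (var x) a))
      cross-pairs = All.map⁺ (All.map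
        (λ {w₁} beside₁ → All.map⁺ (All.map (λ {w₂} → left-vs-right {w₁} {w₂} beside₁) (insertions-beside (var x) b ub)))
        (insertions-beside (var x) a ua))

    eval-insertions-erase : ∀ x (r : Term n) → x ∉ leaves r → ∀ ρ →
      All (λ w → eval w (updateAt ρ x (const e)) ≡ eval r ρ) (insertions (var x) r)
    eval-insertions-erase x r x∉ ρ =
      All.map (λ eq → trans eq (eval-local r _ ρ (λ i∈ → updateAt-minimal _ x ρ (λ { refl → x∉ i∈ }))))
        (eval-insertions-unit (var x) r (updateAt ρ x (const e)) (updateAt-updates x ρ))

    linearTerms-separated : ∀ x xs → Unique (x ∷ xs) → AllPairs Separated (linearTerms x xs)
    linearTerms-separated x []       _          = [] ∷ []
    linearTerms-separated x (y ∷ ys) (x∉ ∷ u) = AllPairs.concat⁺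
      (All.map⁺ (All.map
        (λ {r} ↭r → insertions-separated x r (Unique-resp-↭ (↭-sym ↭r) u) (x∉r {r} ↭r))
        (leaves-linearTerms y ys)))
      (AllPairs.map⁺ (AllPairs-mapWith (λ {r₁} {r₂} → separate-blocks {r₁} {r₂})
        (leaves-linearTerms y ys) (linearTerms-separated y ys u)))
      where
      x∉r : ∀ {r} → leaves r ↭ y ∷ ys → x ∉ leaves r
      x∉r ↭r x∈ = All.lookup x∉ (∈-resp-↭ ↭r x∈) refl
      separate-blocks : ∀ {r₁ r₂} → leaves r₁ ↭ y ∷ ys → leaves r₂ ↭ y ∷ ys → Separated r₁ r₂ →
        All (λ w₁ → All (Separated w₁) (insertions (var x) r₂)) (insertions (var x) r₁)
      separate-blocks {r₁} {r₂} ↭₁ ↭₂ sep =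
        All.tabulate λ {w₁} w₁∈ → All.tabulate λ {w₂} w₂∈ same → sep λ ρ →
        let ρ′ = updateAt ρ x (const e) in begin
        eval r₁ ρ   ≡⟨ All.lookup (eval-insertions-erase x r₁ (x∉r {r₁} ↭₁) ρ) w₁∈ ⟨
        eval w₁ ρ′  ≡⟨ same ρ′ ⟩
        eval w₂ ρ′  ≡⟨ All.lookup (eval-insertions-erase x r₂ (x∉r {r₂} ↭₂) ρ) w₂∈ ⟩
        eval r₂ ρ   ∎
        where open ≡-Reasoning

    -- If the left factor of s = s₁ · s₂ is shorter than that of t = t₁ · t₂,
    -- some β lies in both s₂ and t₁; putting p, q, r at the leftmost variable α
    -- of s₁, at β, and at the leftmost variable γ of t₂, and e elsewhere, s and t
    -- evaluate to p ∙ (q ∙ r) and (p ∙ q) ∙ r.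
    module Unbalanced (s₁ s₂ t₁ t₂ : Term n) (u : Unique (leaves s₁ ++ leaves s₂))
      (eq : leaves s₁ ++ leaves s₂ ≡ leaves t₁ ++ leaves t₂) {β M}
      (t₁≡ : leaves t₁ ≡ leaves s₁ ++ β ∷ M) (s₂≡ : leaves s₂ ≡ β ∷ M ++ leaves t₂) where

      α = leftmost s₁
      γ = leftmost t₂
      α∈s₁ = leftmost∈leaves s₁
      γ∈t₂ = leftmost∈leaves t₂

      β∈s₂ : β ∈ leaves s₂
      β∈s₂ = subst (β ∈_) (sym s₂≡) (here refl)

      γ∈s₂ : γ ∈ leaves s₂
      γ∈s₂ = subst (γ ∈_) (sym s₂≡) (there (Any.++⁺ʳ M γ∈t₂))

      α∈t₁ : α ∈ leaves t₁
      α∈t₁ = subst (α ∈_) (sym t₁≡) (Any.++⁺ˡ α∈s₁)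

      β∈t₁ : β ∈ leaves t₁
      β∈t₁ = subst (β ∈_) (sym t₁≡) (Any.++⁺ʳ (leaves s₁) (here refl))

      ut : Unique (leaves t₁ ++ leaves t₂)
      ut = subst Unique eq u

      s≢ : ∀ {i j} → i ∈ leaves s₁ → j ∈ leaves s₂ → i ≢ j
      s≢ = Unique-++⇒≢ (leaves s₁) u

      t≢ : ∀ {i j} → i ∈ leaves t₁ → j ∈ leaves t₂ → i ≢ j
      t≢ = Unique-++⇒≢ (leaves t₁) ut

      β≢γ : β ≢ γ
      β≢γ with β∉ ∷ _ ← subst Unique s₂≡ (Unique-++⁻ʳ (leaves s₁) u) =
        All.lookup β∉ (Any.++⁺ʳ M γ∈t₂)

      β≢α : β ≢ α
      β≢α = ≢-sym (s≢ α∈s₁ β∈s₂)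

      γ≢α : γ ≢ α
      γ≢α = ≢-sym (s≢ α∈s₁ γ∈s₂)

      module _ (p q r : G) where

        ρ : Fin n → G
        ρ = ⟨ α ↦ p , β ↦ q , γ ↦ r ⟩

        eval-s₁ : eval s₁ ρ ≡ p
        eval-s₁ = trans
          (eval-point s₁ ρ (Unique-++⁻ˡ (leaves s₁) u) α∈s₁
            (λ i∈ i≢α → ⟨⟩-elsewhere i≢α (s≢ i∈ β∈s₂) (s≢ i∈ γ∈s₂)))
          (⟨⟩-at₁ {γ = γ})

        eval-s₂ : eval s₂ ρ ≡ q ∙ r
        eval-s₂ = trans
          (eval-twoPoints s₂ ρ (Unique-++⁻ʳ (leaves s₁) u) β∈s₂ γ∈s₂ β≢γ
            (λ i∈ i≢β i≢γ → ⟨⟩-elsewhere (≢-sym (s≢ α∈s₁ i∈)) i≢β i≢γ))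
          (cong₂ _∙_ (⟨⟩-at₂ β≢α) (⟨⟩-at₃ γ≢α (≢-sym β≢γ)))

        eval-t₁ : eval t₁ ρ ≡ p ∙ q
        eval-t₁ = trans
          (eval-twoPoints t₁ ρ (Unique-++⁻ˡ (leaves t₁) ut) α∈t₁ β∈t₁ (≢-sym β≢α)
            (λ i∈ i≢α i≢β → ⟨⟩-elsewhere i≢α i≢β (t≢ i∈ γ∈t₂)))
          (cong₂ _∙_ (⟨⟩-at₁ {γ = γ}) (⟨⟩-at₂ β≢α))

        eval-t₂ : eval t₂ ρ ≡ r
        eval-t₂ = trans
          (eval-point t₂ ρ (Unique-++⁻ʳ (leaves t₁) ut) γ∈t₂
            (λ i∈ i≢γ → ⟨⟩-elsewhere (≢-sym (t≢ α∈t₁ i∈)) (≢-sym (t≢ β∈t₁ i∈)) i≢γ))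
          (⟨⟩-at₃ γ≢α (≢-sym β≢γ))

    unbalanced-separated : ∀ (s₁ s₂ t₁ t₂ : Term n) → leaves s₁ ++ leaves s₂ ≡ leaves t₁ ++ leaves t₂ →
      Unique (leaves s₁ ++ leaves s₂) → length (leaves s₁) < length (leaves t₁) →
      Separated (s₁ · s₂) (t₁ · t₂)
    unbalanced-separated s₁ s₂ t₁ t₂ eq u shorter same
      with _ , _ , t₁≡ , s₂≡ ← ++-split-< (leaves s₁) (leaves s₂) (leaves t₁) (leaves t₂) eq shorter =
      λ p q r → begin
        (p ∙ q) ∙ r              ≡⟨ cong₂ _∙_ (eval-t₁ p q r) (eval-t₂ p q r) ⟨
        eval (t₁ · t₂) (ρ p q r) ≡⟨ same (ρ p q r) ⟨
        eval (s₁ · s₂) (ρ p q r) ≡⟨ cong₂ _∙_ (eval-s₁ p q r) (eval-s₂ p q r) ⟩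
        p ∙ (q ∙ r)              ∎
      where
      open ≡-Reasoning
      open Unbalanced s₁ s₂ t₁ t₂ u eq t₁≡ s₂≡

    ≢⇒Separated : ∀ (s t : Term n) → leaves s ≡ leaves t → Unique (leaves s) → s ≢ t →
      Separated s t
    ≢⇒Separated (var i) (var j) eq u s≢t = ⊥-elim (s≢t (cong var (∷-injectiveˡ eq)))
    ≢⇒Separated (var i) (c · d) eq u s≢t =
      ⊥-elim (<⇒≱ (2≤length-leaves c d) (≤-reflexive (cong length (sym eq))))
    ≢⇒Separated (a · b) (var j) eq u s≢t =
      ⊥-elim (<⇒≱ (2≤length-leaves a b) (≤-reflexive (cong length eq)))
    ≢⇒Separated (s₁ · s₂) (t₁ · t₂) eq u s≢t with <-cmp (length (leaves s₁)) (length (leaves t₁))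
    ... | tri< shorter _ _ = unbalanced-separated s₁ s₂ t₁ t₂ eq u shorter
    ... | tri> _ _ longer  =
      λ same → unbalanced-separated t₁ t₂ s₁ s₂ (sym eq) (subst Unique eq u) longer (sym ∘ same)
    ... | tri≈ _ balanced _ = balanced-case
      (++-injective-length (leaves s₁) (leaves s₂) (leaves t₁) (leaves t₂) eq balanced) (s₁ ≟ᵀ t₁)
      where
      s₁∉s₂ : ∀ {i} → i ∈ leaves s₁ → i ∉ leaves s₂
      s₁∉s₂ i∈₁ i∈₂ = Unique-++⇒≢ (leaves s₁) u i∈₁ i∈₂ refl
      balanced-case : leaves s₁ ≡ leaves t₁ × leaves s₂ ≡ leaves t₂ → Dec (s₁ ≡ t₁) →
        Separated (s₁ · s₂) (t₁ · t₂)
      balanced-case (_ , s₂≡t₂) (yes refl) =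
        ≢⇒Separated s₂ t₂ s₂≡t₂ (Unique-++⁻ʳ (leaves s₁) u) (s≢t ∘ cong (s₁ ·_))
        ∘ SameOp-cancelˡ s₂ t₂ s₁ s₁
            (λ i∈ → ∉-++⁺ (s₂∉s₁ i∈) (s₂∉s₁ i∈)) (λ i∈ → ∉-++⁺ (t₂∉s₁ i∈) (t₂∉s₁ i∈))
        where
        s₂∉s₁ : ∀ {i} → i ∈ leaves s₂ → i ∉ leaves s₁
        s₂∉s₁ i∈₂ i∈₁ = s₁∉s₂ i∈₁ i∈₂
        t₂∉s₁ : ∀ {i} → i ∈ leaves t₂ → i ∉ leaves s₁
        t₂∉s₁ = s₂∉s₁ ∘ subst (_ ∈_) (sym s₂≡t₂)
      balanced-case (s₁≡t₁ , s₂≡t₂) (no s₁≢t₁) =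
        ≢⇒Separated s₁ t₁ s₁≡t₁ (Unique-++⁻ˡ (leaves s₁) u) s₁≢t₁
        ∘ SameOp-cancelʳ s₁ t₁ s₂ t₂
            (λ i∈ → ∉-++⁺ (s₁∉s₂ i∈) (s₁∉t₂ i∈)) (λ i∈ → ∉-++⁺ (t₁∉s₂ i∈) (s₁∉t₂ (t₁⊆s₁ i∈)))
        where
        t₁⊆s₁ : ∀ {i} → i ∈ leaves t₁ → i ∈ leaves s₁
        t₁⊆s₁ = subst (_ ∈_) (sym s₁≡t₁)
        s₁∉t₂ : ∀ {i} → i ∈ leaves s₁ → i ∉ leaves t₂
        s₁∉t₂ i∈ = s₁∉s₂ i∈ ∘ subst (_ ∈_) (sym s₂≡t₂)
        t₁∉s₂ : ∀ {i} → i ∈ leaves t₁ → i ∉ leaves s₂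
        t₁∉s₂ = s₁∉s₂ ∘ t₁⊆s₁

  module _ (assoc : Associative _≡_ _∙_) where

    isCommutativeMonoid : IsCommutativeMonoid _≡_ _∙_ e
    isCommutativeMonoid = record
      { isMonoid = record
        { isSemigroup = record { isMagma = isMagma _∙_ ; assoc = assoc }
        ; identity    = identity
        }
      ; comm     = comm
      }

    foldr≡foldr∙ : ∀ xs y → foldr _∙_ y xs ≡ foldr _∙_ e xs ∙ y
    foldr≡foldr∙ []       y = sym (idˡ y)
    foldr≡foldr∙ (x ∷ xs) y = trans (cong (x ∙_) (foldr≡foldr∙ xs y)) (sym (assoc x _ y))

    module _ {n : ℕ} where

      eval≡foldr : ∀ (t : Term n) ρ → eval t ρ ≡ foldr _∙_ e (map ρ (leaves t))
      eval≡foldr (var i) ρ = sym (idʳ _)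
      eval≡foldr (a · b) ρ = begin
        eval a ρ ∙ eval b ρ
          ≡⟨ cong₂ _∙_ (eval≡foldr a ρ) (eval≡foldr b ρ) ⟩
        foldr _∙_ e (map ρ (leaves a)) ∙ foldr _∙_ e (map ρ (leaves b))
          ≡⟨ foldr≡foldr∙ (map ρ (leaves a)) _ ⟨
        foldr _∙_ (foldr _∙_ e (map ρ (leaves b))) (map ρ (leaves a))
          ≡⟨ foldr-++ _∙_ e (map ρ (leaves a)) _ ⟨
        foldr _∙_ e (map ρ (leaves a) ++ map ρ (leaves b))
          ≡⟨ cong (foldr _∙_ e) (map-++ ρ (leaves a) (leaves b)) ⟨
        foldr _∙_ e (map ρ (leaves (a · b)))
          ∎
        where open ≡-Reasoning

      ↭⇒SameOp : ∀ {s t : Term n} → leaves s ↭ leaves t → SameOp _∙_ s t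
      ↭⇒SameOp {s} {t} s↭t ρ = begin
        eval s ρ
          ≡⟨ eval≡foldr s ρ ⟩
        foldr _∙_ e (map ρ (leaves s))
          ≡⟨ ↭ₛ.foldr-commMonoid (setoid G) isCommutativeMonoid (↭⇒↭ₛ (↭-map⁺ ρ s↭t)) ⟩
        foldr _∙_ e (map ρ (leaves t))
          ≡⟨ eval≡foldr t ρ ⟨
        eval t ρ
          ∎
        where open ≡-Reasoning

-- Counting term operations

module Counts {G : Set} (_∙_ : Op₂ G) (e : G)
  (comm : Commutative _≡_ _∙_) (identity : Identity _≡_ e _∙_) where

  open Semantics _∙_ e comm identity

  separated⇒NumOps : ∀ {n} {P : Term n → Set} → ¬ Associative _≡_ _∙_ → (ts : List (Term n)) →
    All P ts → AllPairs Separated ts → (∀ t → P t → Any (SameOp _∙_ t) ts) → NumOps _∙_ P (length ts)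
  separated⇒NumOps ¬assoc ts Pts separated complete =
    ts , refl , Pts , AllPairs.map (λ sep → ¬assoc ∘ sep) separated , complete

  bracketings-separated : ∀ m → AllPairs Separated (bracketings m)
  bracketings-separated m = AllPairs-mapWith
    (λ {s} {t} s-brk t-brk → ≢⇒Separated s t (trans s-brk (sym t-brk))
      (subst Unique (sym s-brk) (Unique.allFin⁺ (suc m))))
    (bracketings-Bracketing m) (bracketings-unique m)

  s-is-Catalan : ¬ Associative _≡_ _∙_ → ∀ m → s-is _∙_ (suc m) (Catalan m)
  s-is-Catalan ¬assoc m = subst (NumOps _∙_ Bracketing) (length-bracketings m)
    (separated⇒NumOps ¬assoc (bracketings m) (bracketings-Bracketing m) (bracketings-separated m)
      (λ t t-brk → Any.map (λ { refl ρ → refl }) (bracketings-complete m t t-brk)))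

  sac-is-D : ¬ Associative _≡_ _∙_ → ∀ m → sac-is _∙_ (suc m) (D m)
  sac-is-D ¬assoc m = subst (NumOps _∙_ FullLinear) (length-fullLinearTerms m)
    (separated⇒NumOps ¬assoc (fullLinearTerms m) (leaves-linearTerms zero (tabulate suc))
      (linearTerms-separated zero (tabulate suc) (Unique.allFin⁺ (suc m)))
      (λ t t-lin → Any.map ≈ᶜ⇒SameOp (linearTerms-complete zero (tabulate suc) t t-lin)))

  module _ (assoc : Associative _≡_ _∙_) where

    ↭-representative⇒NumOps-1 : ∀ {n} {P : Term n → Set} t₀ → P t₀ → (∀ t → P t → leaves t ↭ leaves t₀) →
      NumOps _∙_ P 1
    ↭-representative⇒NumOps-1 t₀ P-t₀ ↭t₀ =
      t₀ ∷ [] , refl , P-t₀ ∷ [] , [] ∷ [] , λ t P-t → here (↭⇒SameOp assoc {s = t} {t = t₀} (↭t₀ t P-t))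

    s-is-one : ∀ m → s-is _∙_ (suc m) 1
    s-is-one m = ↭-representative⇒NumOps-1 (spineBracketing m) (spineBracketing-Bracketing m)
      (λ t t-brk → ↭-reflexive (trans t-brk (sym (spineBracketing-Bracketing m))))

    sac-is-one : ∀ m → sac-is _∙_ (suc m) 1
    sac-is-one m = ↭-representative⇒NumOps-1 (spineBracketing m) (↭-reflexive (spineBracketing-Bracketing m))
      (λ t t-lin → ↭-trans t-lin (↭-sym (↭-reflexive (spineBracketing-Bracketing m))))

theorem4p6 : (G : Set) (_∙_ : G → G → G) (e : G) →
    Commutative _≡_ _∙_ → Identity _≡_ e _∙_ →
    (Associative _≡_ _∙_ →
      ∀ (n : ℕ) → 1 ≤ n → s-is _∙_ n 1 × sac-is _∙_ n 1)
    × (¬ Associative _≡_ _∙_ →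
      ∀ (n : ℕ) → 1 ≤ n →
        s-is _∙_ n (Catalan (n ∸ 1)) × sac-is _∙_ n (D (n ∸ 1)))
theorem4p6 G _∙_ e comm identity =
  (λ { assoc (suc m) _ → s-is-one assoc m , sac-is-one assoc m }) ,
  (λ { ¬assoc (suc m) _ → s-is-Catalan ¬assoc m , sac-is-D ¬assoc m })
  where open Counts _∙_ e comm identity
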